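{- Let $T$ be a hypertree on $[n]$ and let $\Sigma\subseteq S_n$ be a collection of cycles whose supports are exactly the edges of $T$ (one cycle for each edge). Then the product $\prod_{\sigma\in\Sigma}\sigma$, taken in any order, is an $n$-cycle.
   Context: The support of $\sigma\in S_n$ is $\{i:\sigma(i)\neq i\}$. A hypergraph is a pair $(V,E)$ with $E\subseteq2^V\setminus\{\emptyset\}$. A path in a hypergraph is a sequence $v_1,e_1,\ldots,v_k,e_k,v_{k+1}$ with $k>1$, $v_i$ vertices, $e_i$ edges, $v_1\in e_1$, $v_{k+1}\in e_k$, $v_i\in e_{i-1}\cap e_i$ for $2\le i\le k$, all entries distinct except possibly $v_{k+1}=v_1$; it is a cycle if $v_{k+1}=v_1$. A hyperforest is a hypergraph with no cycles. A hypergraph is connected if there is no nontrivial partition $V=V_1\sqcup V_2$ with every edge contained in $V_1$ or in $V_2$. A hypertree is a connected hyperforest. -}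

module Defs where

open import Data.Nat using (ℕ; zero; suc)
open import Data.Fin using (Fin; zero; suc; fromℕ; inject₁)
open import Data.Fin.Subset using (Subset; _∈_; Nonempty)
open import Data.Fin.Permutation using (Permutation′; _⟨$⟩ʳ_; _∘ₚ_; id)
open import Data.Bool using (Bool)
open import Data.Product using (Σ; ∃; _×_)
open import Relation.Binary.PropositionalEquality using (_≡_; _≢_)
open import Function.Definitions using (Injective)
open import Function.Bundles using (_⇔_)

_^_$_ : ∀ {n} → Permutation′ n → ℕ → Fin n → Fin n
σ ^ zero $ x = x
σ ^ suc k $ x = σ ⟨$⟩ʳ (σ ^ k $ x)

InSupport : ∀ {n} → Permutation′ n → Fin n → Set
InSupport σ i = σ ⟨$⟩ʳ i ≢ i

IsCycle : ∀ {n} → Permutation′ n → Set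
IsCycle {n} σ = Σ (Fin n) λ x → InSupport σ x ×
  ((y : Fin n) → InSupport σ y → ∃ λ k → σ ^ k $ y ≡ x)

IsFullCycle : ∀ {n} → Permutation′ n → Set
IsFullCycle {n} σ = (x y : Fin n) → ∃ λ k → σ ^ k $ x ≡ y

-- product of a finite family of permutations, σ 0 σ 1 ... σ (k-1)
-- (composition order of _∘ₚ_ is diagrammatic; irrelevant since the
--  statement quantifies over all orders)
prod : ∀ {n k} → (Fin k → Permutation′ n) → Permutation′ n
prod {k = zero} σ = id
prod {k = suc k} σ = σ zero ∘ₚ prod (λ i → σ (suc i))

-- A hypergraph on vertex set Fin n with m edges, given as an injective
-- family of nonempty subsets (so the edge set is {E i}).
record Hypergraph (n m : ℕ) : Set where
  field
    edge     : Fin m → Subset n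
    edge-inj : Injective _≡_ _≡_ edge
    edge-ne  : (i : Fin m) → Nonempty (edge i)
open Hypergraph public

-- A cycle v₁,e₁,…,v_k,e_k,v₁ with k = suc (suc j) ≥ 2, distinct vertices
-- and distinct edges, vᵢ ∈ eᵢ, v_{i+1} ∈ eᵢ, v₁ ∈ e_k.
record HCycle {n m : ℕ} (H : Hypergraph n m) : Set where
  field
    j      : ℕ
    vert   : Fin (suc (suc j)) → Fin n
    edg    : Fin (suc (suc j)) → Fin m
    v-inj  : Injective _≡_ _≡_ vert
    e-inj  : Injective _≡_ _≡_ edg
    v∈e    : (i : Fin (suc (suc j))) → vert i ∈ edge H (edg i)
    next∈e : (i : Fin (suc j)) → vert (suc i) ∈ edge H (edg (inject₁ i))
    wrap   : vert zero ∈ edge H (edg (fromℕ (suc j)))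

IsHyperforest : ∀ {n m} → Hypergraph n m → Set
IsHyperforest H = HCycle H → Data.Empty.⊥
  where import Data.Empty

-- connected: no nontrivial partition V = V₁ ⊔ V₂ (encoded by P : Fin n → Bool)
-- with every edge inside V₁ or inside V₂
IsConnected : ∀ {n m} → Hypergraph n m → Set
IsConnected {n} {m} H = (P : Fin n → Bool) →
  ((i : Fin m) (x y : Fin n) → x ∈ edge H i → y ∈ edge H i → P x ≡ P y) →
  (x y : Fin n) → P x ≡ P y

IsHypertree : ∀ {n m} → Hypergraph n m → Set
IsHypertree H = IsConnected H × IsHyperforest H

module Submission where

-- Let τ list distinct edges and write the product as c ∘ₚ q with c = σ (τ 0)
-- and q the product of the remaining factors.  By induction, q-orbits contain
-- the components of the edges τ 1, …, and conversely a q-orbit is traced by a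
-- walk in those edges.  As T has no cycles, such a walk cannot join two vertices
-- of the edge τ 0 = supp c, so every q-orbit meets supp c at most once.  Then
-- composing with the cycle c fuses the q-orbits meeting supp c into one orbit
-- and keeps the others, so orbits of the product contain the components of all
-- edges τ j.  Since T is connected, the whole product has a single orbit.

open import Defs
open import Data.Bool using (true; false)
open import Data.Nat using (ℕ; zero; suc; _+_; _*_)
open import Data.Nat.Properties using (+-comm; +-suc; *-suc; n<1+n; m≤n⇒∃[o]m+o≡n)
open import Data.Nat.DivMod using (_divMod_; result)
open import Data.Fin using (Fin; zero; suc; toℕ; fromℕ; inject₁)
open import Data.Fin.Properties
  using (any?; pigeonhole; suc-injective; inject₁-injective; fromℕ≢inject₁)
  renaming (_≟_ to _≟ᶠ_)
open import Data.Fin.Subset using (Subset; _∈_)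
open import Data.Fin.Permutation using (Permutation′; _⟨$⟩ʳ_; _⟨$⟩ˡ_; _∘ₚ_; inverseʳ)
open import Data.Vec.Functional using (_∷_)
open import Data.Product using (Σ; ∃; _×_; _,_; proj₁; proj₂)
open import Data.Sum using (_⊎_; inj₁; inj₂)
open import Data.Empty using (⊥-elim)
open import Level using (0ℓ)
open import Function using (_∘_)
open import Function.Bundles using (_⇔_; mk⇔; Injection; Equivalence)
open import Function.Definitions using (Injective)
open import Function.Properties.Inverse using (↔⇒↣)
open import Relation.Binary.Core using (Rel)
open import Relation.Binary.Definitions using (Decidable)
open import Relation.Binary.Structures using (IsDecEquivalence)
open import Relation.Nullary using (¬_; yes; no; does; contradiction)
open import Relation.Nullary.Decidable using (dec-true; dec-false; does-⇔)
import Relation.Nullary.Decidable as Dec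
open import Relation.Binary.PropositionalEquality
  using (_≡_; _≢_; refl; sym; trans; cong; subst; module ≡-Reasoning)

open Equivalence using (to; from)

∷-injective : ∀ {A : Set} {k} {a : A} {f : Fin k → A} →
  ¬ (∃ λ t → a ≡ f t) → Injective _≡_ _≡_ f → Injective _≡_ _≡_ (a ∷ f)
∷-injective a∉f f-inj {zero}  {zero}  _  = refl
∷-injective a∉f f-inj {zero}  {suc j} eq = ⊥-elim (a∉f (j , eq))
∷-injective a∉f f-inj {suc i} {zero}  eq = ⊥-elim (a∉f (i , sym eq))
∷-injective a∉f f-inj {suc i} {suc j} eq = cong suc (f-inj eq)

Orbit : ∀ {n} → Permutation′ n → Rel (Fin n) 0ℓ
Orbit p x y = ∃ λ k → p ^ k $ x ≡ y

module _ {n} (p : Permutation′ n) where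
  open ≡-Reasoning

  ⟨$⟩ʳ-injective : Injective _≡_ _≡_ (p ⟨$⟩ʳ_)
  ⟨$⟩ʳ-injective = Injection.injective (↔⇒↣ p)

  iterate-+ : ∀ a b x → p ^ (a + b) $ x ≡ p ^ a $ (p ^ b $ x)
  iterate-+ zero    b x = refl
  iterate-+ (suc a) b x = cong (p ⟨$⟩ʳ_) (iterate-+ a b x)

  iterate-injective : ∀ k → Injective _≡_ _≡_ (p ^ k $_)
  iterate-injective zero    eq = eq
  iterate-injective (suc k) eq = iterate-injective k (⟨$⟩ʳ-injective eq)

  iterate-periodic : ∀ x → ∃ λ d → p ^ suc d $ x ≡ x
  iterate-periodic x with pigeonhole (n<1+n n) (λ i → p ^ toℕ i $ x)
  ... | i , j , i<j , pⁱx≡pʲx with m≤n⇒∃[o]m+o≡n i<j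
  ... | d , 1+i+d≡j = d , iterate-injective (toℕ i) (begin
    p ^ toℕ i $ (p ^ suc d $ x)  ≡⟨ iterate-+ (toℕ i) (suc d) x ⟨
    p ^ (toℕ i + suc d) $ x      ≡⟨ cong (p ^_$ x) (trans (+-suc (toℕ i) d) 1+i+d≡j) ⟩
    p ^ toℕ j $ x                ≡⟨ pⁱx≡pʲx ⟨
    p ^ toℕ i $ x                ∎)

  iterate-*-period : ∀ {d x} → p ^ suc d $ x ≡ x → ∀ q → p ^ (q * suc d) $ x ≡ x
  iterate-*-period period zero    = refl
  iterate-*-period {d} {x} period (suc q) = begin
    p ^ (suc d + q * suc d) $ x    ≡⟨ iterate-+ (suc d) (q * suc d) x ⟩
    p ^ suc d $ (p ^ (q * suc d) $ x) ≡⟨ cong (p ^ suc d $_) (iterate-*-period period q) ⟩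
    p ^ suc d $ x                  ≡⟨ period ⟩
    x                              ∎

  Orbit-step : ∀ x → Orbit p x (p ⟨$⟩ʳ x)
  Orbit-step x = 1 , refl

  Orbit-refl : ∀ {x} → Orbit p x x
  Orbit-refl = 0 , refl

  Orbit-trans : ∀ {x y z} → Orbit p x y → Orbit p y z → Orbit p x z
  Orbit-trans {x} (a , refl) (b , refl) = b + a , iterate-+ b a x

  Orbit-sym : ∀ {x y} → Orbit p x y → Orbit p y x
  Orbit-sym {x} (k , refl) with iterate-periodic x
  ... | d , period = k * d , (begin
    p ^ (k * d) $ (p ^ k $ x)  ≡⟨ iterate-+ (k * d) k x ⟨
    p ^ (k * d + k) $ x        ≡⟨ cong (p ^_$ x) (trans (+-comm (k * d) k) (sym (*-suc k d))) ⟩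
    p ^ (k * suc d) $ x        ≡⟨ iterate-*-period period k ⟩
    x                          ∎)

  Orbit? : Decidable (Orbit p)
  Orbit? x y with iterate-periodic x
  ... | d , period = Dec.map (mk⇔ (λ (r , e) → toℕ r , e) within-period)
                             (any? λ r → p ^ toℕ r $ x ≟ᶠ y)
    where
    within-period : Orbit p x y → ∃ λ (r : Fin (suc d)) → p ^ toℕ r $ x ≡ y
    within-period (k , pᵏx≡y) with k divMod suc d
    ... | result q r k≡r+q*[1+d] = r , (begin
      p ^ toℕ r $ x                      ≡⟨ cong (p ^ toℕ r $_) (iterate-*-period period q) ⟨
      p ^ toℕ r $ (p ^ (q * suc d) $ x)  ≡⟨ iterate-+ (toℕ r) (q * suc d) x ⟨
      p ^ (toℕ r + q * suc d) $ x        ≡⟨ cong (p ^_$ x) k≡r+q*[1+d] ⟨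
      p ^ k $ x                          ≡⟨ pᵏx≡y ⟩
      y                                  ∎)

  Orbit-isDecEquivalence : IsDecEquivalence (Orbit p)
  Orbit-isDecEquivalence = record
    { isEquivalence = record { refl = Orbit-refl ; sym = Orbit-sym ; trans = Orbit-trans }
    ; _≟_ = Orbit?
    }

InSupport-step : ∀ {n} (c : Permutation′ n) {s} → InSupport c s → InSupport c (c ⟨$⟩ʳ s)
InSupport-step c s∈ = s∈ ∘ ⟨$⟩ʳ-injective c

InSupport-^ : ∀ {n} (c : Permutation′ n) {s} → InSupport c s → ∀ k → InSupport c (c ^ k $ s)
InSupport-^ c s∈ zero    = s∈
InSupport-^ c s∈ (suc k) = InSupport-step c (InSupport-^ c s∈ k)

module _ {n m} {T : Hypergraph n m} (connected : IsConnected T)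
         {_∼_ : Rel (Fin n) 0ℓ} (∼-isDecEquivalence : IsDecEquivalence _∼_) where
  open IsDecEquivalence ∼-isDecEquivalence
    using (_≟_) renaming (refl to ∼-refl; trans to ∼-trans)
  open ≡-Reasoning

  connected⇒total : (∀ i {x y} → x ∈ edge T i → y ∈ edge T i → x ∼ y) → ∀ x y → x ∼ y
  connected⇒total edge⇒∼ x y with x ≟ y
  ... | yes x∼y = x∼y
  ... | no x≁y = contradiction true≡false λ ()
    where
    edge-respects : ∀ i u v → u ∈ edge T i → v ∈ edge T i → does (x ≟ u) ≡ does (x ≟ v)
    edge-respects i u v u∈ v∈ =
      does-⇔ (mk⇔ (λ x∼u → ∼-trans x∼u (edge⇒∼ i u∈ v∈)) (λ x∼v → ∼-trans x∼v (edge⇒∼ i v∈ u∈)))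
             (x ≟ u) (x ≟ v)

    true≡false = begin
      true           ≡⟨ dec-true (x ≟ x) ∼-refl ⟨
      does (x ≟ x)   ≡⟨ connected (λ z → does (x ≟ z)) edge-respects x y ⟩
      does (x ≟ y)   ≡⟨ dec-false (x ≟ y) x≁y ⟩
      false          ∎

module Walks {n m} (E : Fin m → Subset n) where

  data Walk (A : Fin m → Set) : Fin n → Fin n → Set where
    []   : ∀ {x} → Walk A x x
    step : ∀ {x y z} i → A i → x ∈ E i → y ∈ E i → Walk A y z → Walk A x z

  weaken : ∀ {A B : Fin m → Set} → (∀ {i} → A i → B i) → ∀ {x z} → Walk A x z → Walk B x z
  weaken A⇒B []                 = []
  weaken A⇒B (step i a x∈ y∈ w) = step i (A⇒B a) x∈ y∈ (weaken A⇒B w)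

  module _ {A : Fin m → Set} where

    infixr 5 _++_
    _++_ : ∀ {x y z} → Walk A x y → Walk A y z → Walk A x z
    []                 ++ w′ = w′
    step i a x∈ y∈ w   ++ w′ = step i a x∈ y∈ (w ++ w′)

    length : ∀ {x z} → Walk A x z → ℕ
    length []                 = 0
    length (step _ _ _ _ w)   = suc (length w)

    vertices : ∀ {x z} (w : Walk A x z) → Fin (suc (length w)) → Fin n
    vertices {x} w              zero    = x
    vertices (step _ _ _ _ w)   (suc t) = vertices w t

    edges : ∀ {x z} (w : Walk A x z) → Fin (length w) → Fin m
    edges (step i _ _ _ w) zero    = i
    edges (step _ _ _ _ w) (suc t) = edges w t

    _∈ᵛ_ : ∀ {x z} → Fin n → Walk A x z → Set
    v ∈ᵛ w = ∃ λ t → v ≡ vertices w t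

    _∈ᵉ_ : ∀ {x z} → Fin m → Walk A x z → Set
    i ∈ᵉ w = ∃ λ t → i ≡ edges w t

    data Simple : ∀ {x z} → Walk A x z → Set where
      []   : ∀ {x} → Simple ([] {x = x})
      step : ∀ {x y z i a x∈ y∈} {w : Walk A y z} →
             ¬ x ∈ᵛ w → ¬ i ∈ᵉ w → Simple w → Simple (step {x = x} i a x∈ y∈ w)

    vertices-last : ∀ {x z} (w : Walk A x z) → vertices w (fromℕ (length w)) ≡ z
    vertices-last []                 = refl
    vertices-last (step _ _ _ _ w)   = vertices-last w

    vertex-in-edge : ∀ {x z} (w : Walk A x z) t → vertices w (inject₁ t) ∈ E (edges w t)
    vertex-in-edge (step _ _ x∈ _ w) zero    = x∈
    vertex-in-edge (step _ _ _ _ w)  (suc t) = vertex-in-edge w t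

    next-vertex-in-edge : ∀ {x z} (w : Walk A x z) t → vertices w (suc t) ∈ E (edges w t)
    next-vertex-in-edge (step _ _ _ y∈ w) zero    = y∈
    next-vertex-in-edge (step _ _ _ _ w)  (suc t) = next-vertex-in-edge w t

    edges-allowed : ∀ {x z} (w : Walk A x z) t → A (edges w t)
    edges-allowed (step _ a _ _ w) zero    = a
    edges-allowed (step _ _ _ _ w) (suc t) = edges-allowed w t

    vertices-injective : ∀ {x z} {w : Walk A x z} → Simple w → Injective _≡_ _≡_ (vertices w)
    vertices-injective []              {zero}  {zero}  _  = refl
    vertices-injective (step _ _ _)    {zero}  {zero}  _  = refl
    vertices-injective (step x∉w _ _)  {zero}  {suc t} eq = ⊥-elim (x∉w (t , eq))
    vertices-injective (step x∉w _ _)  {suc s} {zero}  eq = ⊥-elim (x∉w (s , sym eq))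
    vertices-injective (step _ _ simple) {suc s} {suc t} eq = cong suc (vertices-injective simple eq)

    edges-injective : ∀ {x z} {w : Walk A x z} → Simple w → Injective _≡_ _≡_ (edges w)
    edges-injective (step _ _ _)      {zero}  {zero}  _  = refl
    edges-injective (step _ i∉w _)    {zero}  {suc t} eq = ⊥-elim (i∉w (t , eq))
    edges-injective (step _ i∉w _)    {suc s} {zero}  eq = ⊥-elim (i∉w (s , sym eq))
    edges-injective (step _ _ simple) {suc s} {suc t} eq = cong suc (edges-injective simple eq)

    drop : ∀ {x z} (w : Walk A x z) (t : Fin (suc (length w))) → Walk A (vertices w t) z
    drop w                  zero    = w
    drop (step _ _ _ _ w)   (suc t) = drop w t

    drop-⊆ᵛ : ∀ {x z} (w : Walk A x z) t {v} → v ∈ᵛ drop w t → v ∈ᵛ w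
    drop-⊆ᵛ w                zero    v∈ = v∈
    drop-⊆ᵛ (step _ _ _ _ w) (suc t) v∈ with drop-⊆ᵛ w t v∈
    ... | s , v≡ = suc s , v≡

    drop-simple : ∀ {x z} {w : Walk A x z} → Simple w → ∀ t → Simple (drop w t)
    drop-simple simple            zero    = simple
    drop-simple (step _ _ simple) (suc t) = drop-simple simple t

    drop-after-edge : ∀ {x z} {w : Walk A x z} → Simple w → ∀ t → ¬ edges w t ∈ᵉ drop w (suc t)
    drop-after-edge (step _ i∉w _)    zero    = i∉w
    drop-after-edge (step _ _ simple) (suc t) = drop-after-edge simple t

    -- A repeated vertex is cut out by jumping to its later occurrence, a
    -- repeated edge by leaving through it at its later occurrence.
    simplify : ∀ {x z} → Walk A x z → Σ (Walk A x z) Simple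
    simplify [] = [] , []
    simplify {x} (step i a x∈ y∈ w) with simplify w
    ... | w′ , simple with any? (λ t → x ≟ᶠ vertices w′ t)
    ...   | yes (t , refl) = drop w′ t , drop-simple simple t
    ...   | no x∉w′ with any? (λ t → i ≟ᶠ edges w′ t)
    ...     | yes (t , refl) =
                step (edges w′ t) a x∈ (next-vertex-in-edge w′ t) (drop w′ (suc t)) ,
                step (x∉w′ ∘ drop-⊆ᵛ w′ (suc t)) (drop-after-edge simple t) (drop-simple simple (suc t))
    ...     | no i∉w′ = step i a x∈ y∈ w′ , step x∉w′ i∉w′ simple

module _ {n m} {T : Hypergraph n m} (forest : IsHyperforest T) where
  open Walks (edge T)

  -- A simple walk b ⇝ a avoiding e, closed up by e itself, is a hypergraph cycle.
  avoiding-walk⇒≡ : ∀ {e a b} → a ∈ edge T e → b ∈ edge T e → Walk (_≢ e) b a → a ≡ b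
  avoiding-walk⇒≡ {e} {a} {b} a∈e b∈e w with simplify w
  ... | [] , _ = refl
  ... | p@(step _ _ _ _ p′) , simple = ⊥-elim (forest record
    { j      = length p′
    ; vert   = a ∷ (vertices p ∘ inject₁)
    ; edg    = e ∷ edges p
    ; v-inj  = ∷-injective a∉p (λ eq → inject₁-injective (vertices-injective simple eq))
    ; e-inj  = ∷-injective (λ (t , e≡) → edges-allowed p t (sym e≡)) (edges-injective simple)
    ; v∈e    = λ { zero → a∈e ; (suc t) → vertex-in-edge p t }
    ; next∈e = λ { zero → b∈e ; (suc t) → next-vertex-in-edge p (inject₁ t) }
    ; wrap   = subst (_∈ edge T (edges p (fromℕ (length p′)))) (vertices-last p)
                     (next-vertex-in-edge p (fromℕ (length p′)))
    })
    where
    a∉p : ¬ (∃ λ t → a ≡ vertices p (inject₁ t))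
    a∉p (t , a≡) = fromℕ≢inject₁ {i = t} (vertices-injective simple (trans (vertices-last p) a≡))

-- _∘ₚ_ composes diagrammatically: p x = q (c x).
module ∘ₚ-Orbits {n} (c q : Permutation′ n) (c-cycle : IsCycle c)
  (transversal : ∀ {s s′} → InSupport c s → InSupport c s′ → Orbit q s s′ → s ≡ s′) where

  p : Permutation′ n
  p = c ∘ₚ q

  agree-until-support : ∀ k y →
    p ^ k $ y ≡ q ^ k $ y ⊎ ∃ λ s → InSupport c s × Orbit p y s × Orbit q y s
  agree-until-support zero    y = inj₁ refl
  agree-until-support (suc k) y with agree-until-support k y
  ... | inj₂ hit = inj₂ hit
  ... | inj₁ pᵏy≡qᵏy with c ⟨$⟩ʳ (q ^ k $ y) ≟ᶠ q ^ k $ y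
  ...   | yes fixed = inj₁ (cong (q ⟨$⟩ʳ_) (trans (cong (c ⟨$⟩ʳ_) pᵏy≡qᵏy) fixed))
  ...   | no moved  = inj₂ (q ^ k $ y , moved , (k , pᵏy≡qᵏy) , (k , refl))

  -- Follow p from p s = q (c s) along the q-orbit back to c s; the first
  -- point of supp c met on the way lies on the q-orbit of c s, so it is c s.
  support-step : ∀ {s} → InSupport c s → Orbit p s (c ⟨$⟩ʳ s)
  support-step {s} s∈ with Orbit-sym q (Orbit-step q (c ⟨$⟩ʳ s))
  ... | k , back with agree-until-support k (p ⟨$⟩ʳ s)
  ...   | inj₁ agree = Orbit-trans p (Orbit-step p s) (k , trans agree back)
  ...   | inj₂ (s′ , s′∈ , ps⇝s′ , qps⇝s′) =
    subst (Orbit p s) (sym (transversal (InSupport-step c s∈) s′∈ (Orbit-trans q (Orbit-step q _) qps⇝s′)))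
          (Orbit-trans p (Orbit-step p s) ps⇝s′)

  iterate-in-orbit : ∀ {s} → InSupport c s → ∀ k → Orbit p s (c ^ k $ s)
  iterate-in-orbit s∈ zero    = Orbit-refl p
  iterate-in-orbit s∈ (suc k) = Orbit-trans p (iterate-in-orbit s∈ k) (support-step (InSupport-^ c s∈ k))

  iterate-to-centre : ∀ {s} → InSupport c s → Orbit p s (proj₁ c-cycle)
  iterate-to-centre {s} s∈ with proj₂ (proj₂ c-cycle) s s∈
  ... | k , cᵏs≡centre = subst (Orbit p s) cᵏs≡centre (iterate-in-orbit s∈ k)

  support-in-one-orbit : ∀ {s s′} → InSupport c s → InSupport c s′ → Orbit p s s′
  support-in-one-orbit s∈ s′∈ = Orbit-trans p (iterate-to-centre s∈) (Orbit-sym p (iterate-to-centre s′∈))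

  Orbit-mono : ∀ {u v} → Orbit q u v → Orbit p u v
  Orbit-mono {u} {v} (k , qᵏu≡v) with agree-until-support k u
  ... | inj₁ agree = k , trans agree qᵏu≡v
  ... | inj₂ (s , s∈ , u⇝s , _) with Orbit-sym q (k , qᵏu≡v)
  ...   | k′ , qᵏ′v≡u with agree-until-support k′ v
  ...     | inj₁ agree = Orbit-sym p (k′ , trans agree qᵏ′v≡u)
  ...     | inj₂ (s′ , s′∈ , v⇝s′ , _) =
    Orbit-trans p u⇝s (Orbit-trans p (support-in-one-orbit s∈ s′∈) (Orbit-sym p v⇝s′))

module CycleFamily {n m} (T : Hypergraph n m) (forest : IsHyperforest T)
  (σ : Fin m → Permutation′ n) (σ-cycle : ∀ i → IsCycle (σ i))
  (edge⇔support : ∀ i x → (x ∈ edge T i) ⇔ InSupport (σ i) x) where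
  open Walks (edge T)

  InImage : ∀ {k} → (Fin k → Fin m) → Fin m → Set
  InImage τ i = ∃ λ j → τ j ≡ i

  σ-walk : ∀ {A : Fin m → Set} i → A i → ∀ u → Walk A u (σ i ⟨$⟩ʳ u)
  σ-walk i a u with σ i ⟨$⟩ʳ u ≟ᶠ u
  ... | yes fixed = subst (Walk _ u) (sym fixed) []
  ... | no moved  = step i a (from (edge⇔support i _) moved)
                             (from (edge⇔support i _) (InSupport-step (σ i) moved)) []

  prod-walk : ∀ {k} (τ : Fin k → Fin m) u → Walk (InImage τ) u (prod (σ ∘ τ) ⟨$⟩ʳ u)
  prod-walk {zero}  τ u = []
  prod-walk {suc k} τ u =
    σ-walk (τ zero) (zero , refl) u ++ weaken (λ (j , τj≡i) → suc j , τj≡i) (prod-walk (τ ∘ suc) _)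

  orbit⇒walk : ∀ {k} (τ : Fin k → Fin m) {u v} → Orbit (prod (σ ∘ τ)) u v → Walk (InImage τ) u v
  orbit⇒walk τ (zero  , refl) = []
  orbit⇒walk τ (suc k , refl) = orbit⇒walk τ (k , refl) ++ prod-walk τ _

  -- A q-orbit joining two points of supp σ(τ 0) yields a walk avoiding the edge τ 0.
  tail-transversal : ∀ {k} (τ : Fin (suc k) → Fin m) → Injective _≡_ _≡_ τ →
    ∀ {s s′} → InSupport (σ (τ zero)) s → InSupport (σ (τ zero)) s′ →
    Orbit (prod (σ ∘ τ ∘ suc)) s s′ → s ≡ s′
  tail-transversal τ τ-inj s∈ s′∈ s⇝s′ =
    sym (avoiding-walk⇒≡ forest (from (edge⇔support _ _) s′∈) (from (edge⇔support _ _) s∈)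
                                (weaken avoids-head (orbit⇒walk (τ ∘ suc) s⇝s′)))
    where
    avoids-head : ∀ {i} → InImage (τ ∘ suc) i → i ≢ τ zero
    avoids-head (j , refl) = (λ ()) ∘ τ-inj

  module Head {k} (τ : Fin (suc k) → Fin m) (τ-inj : Injective _≡_ _≡_ τ) =
    ∘ₚ-Orbits (σ (τ zero)) (prod (σ ∘ τ ∘ suc)) (σ-cycle _) (tail-transversal τ τ-inj)

  edge⇒orbit : ∀ {k} (τ : Fin k → Fin m) → Injective _≡_ _≡_ τ →
    ∀ j {u v} → u ∈ edge T (τ j) → v ∈ edge T (τ j) → Orbit (prod (σ ∘ τ)) u v
  edge⇒orbit τ τ-inj zero u∈ v∈ =
    Head.support-in-one-orbit τ τ-inj (to (edge⇔support _ _) u∈) (to (edge⇔support _ _) v∈)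
  edge⇒orbit τ τ-inj (suc j) u∈ v∈ =
    Head.Orbit-mono τ τ-inj (edge⇒orbit (τ ∘ suc) (suc-injective ∘ τ-inj) j u∈ v∈)

  walk⇒orbit : ∀ {k} (τ : Fin k → Fin m) → Injective _≡_ _≡_ τ →
    ∀ {u v} → Walk (InImage τ) u v → Orbit (prod (σ ∘ τ)) u v
  walk⇒orbit τ τ-inj [] = Orbit-refl _
  walk⇒orbit τ τ-inj (step _ (j , refl) u∈ y∈ w) =
    Orbit-trans _ (edge⇒orbit τ τ-inj j u∈ y∈) (walk⇒orbit τ τ-inj w)

lemma2p22 : (n m : ℕ) (T : Hypergraph n m) → IsHypertree T →
    (σ : Fin m → Permutation′ n) →
    ((i : Fin m) → IsCycle (σ i)) →
    ((i : Fin m) (x : Fin n) → (x ∈ edge T i) ⇔ InSupport (σ i) x) →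
    (π : Permutation′ m) →
    IsFullCycle (prod (λ i → σ (π ⟨$⟩ʳ i)))
lemma2p22 n m T (connected , forest) σ σ-cycle edge⇔support π =
  connected⇒total {T = T} connected (Orbit-isDecEquivalence (prod (σ ∘ (π ⟨$⟩ʳ_)))) edge⇒orbit
  where
  open Walks (edge T)
  open CycleFamily T forest σ σ-cycle edge⇔support using (walk⇒orbit)

  edge⇒orbit : ∀ i {x y} → x ∈ edge T i → y ∈ edge T i → Orbit (prod (σ ∘ (π ⟨$⟩ʳ_))) x y
  edge⇒orbit i x∈ y∈ =
    walk⇒orbit (π ⟨$⟩ʳ_) (⟨$⟩ʳ-injective π) (step i (π ⟨$⟩ˡ i , inverseʳ π) x∈ y∈ [])
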